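{- Every formula $\varphi$ of $\mu\mathtt{NML}$ is equivalent (true in exactly the same pointed monotone neighborhood models) to the $\mathtt{NMSO}$ formula $c(\varphi) := \exists p\,\exists q\,( sr(q)\wedge q\subseteq p\wedge \mathtt{Eq}(\varphi,p))$, where $p$ is a variable not occurring in $\varphi$ and $q$ does not occur in $\mathtt{Eq}(\varphi,p)$.
   Context: A monotone neighborhood model is $\mathbb{S}=(S,\sigma,V)$ with $\sigma:S\to\mathcal{P}\mathcal{P}(S)$ upward closed and $V$ a valuation of propositional variables. $\mu\mathtt{NML}$ is the monotone modal $\mu$-calculus (formulas built from $p,\neg p,\wedge,\vee,\Box,\Diamond,\mu,\nu$). $\mathtt{NMSO}$ is the monadic second-order language with atoms $sr(p)$ ($V(p)=\{s\}$ at the current point $s$), $p\subseteq q$ ($V(p)\subseteq V(q)$), $\Box(p,q)$ ($V(q)\in\sigma(t)$ for all $t\in V(p)$), Boolean connectives and second-order quantification $\exists p$. For each $\varphi\in\mu\mathtt{NML}$ and variable $p$, $\mathtt{Eq}(\varphi,p)$ is an $\mathtt{NMSO}$ formula such that $(\mathbb{S},s)\vDash\mathtt{Eq}(\varphi,p)$ iff $V(p)$ equals the set of states of $\mathbb{S}$ at which $\varphi$ is true. -}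

module Defs where

open import Data.Nat using (ℕ; _≟_)
open import Data.Bool using (Bool; true; false; T; not; if_then_else_)
  renaming (_∧_ to _and_; _∨_ to _or_)
open import Data.Product using (Σ; _×_; _,_)
open import Data.Sum using (_⊎_)
open import Data.Empty using (⊥)
open import Data.Unit using (⊤)
open import Relation.Nullary using (¬_; Dec)
open import Relation.Nullary.Decidable using (⌊_⌋)
open import Relation.Binary.PropositionalEquality using (_≡_; _≢_)
open import Function.Bundles using (_⇔_)

-- Subsets of the state space are Boolean-valued
-- predicates S → Bool; with excluded middle these are exactly all subsets.
-- This keeps the (impredicative) fixpoint semantics inside Set.

LEM : Set₁
LEM = (P : Set) → Dec P

Var : Set
Var = ℕ

Subset : Set → Set
Subset S = S → Bool

record Frame : Set₁ where
  field
    St     : Set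
    σ      : St → Subset St → Set
    upward : ∀ {s : St} {X Y : Subset St} →
             (∀ t → T (X t) → T (Y t)) → σ s X → σ s Y
open Frame public

Valuation : Frame → Set
Valuation F = Var → Subset (St F)

_[_↦_] : {F : Frame} → Valuation F → Var → Subset (St F) → Valuation F
(V [ p ↦ X ]) q = if ⌊ q ≟ p ⌋ then X else V q

data Fml : Set where
  var  : Var → Fml
  nvar : Var → Fml
  _∧̇_  : Fml → Fml → Fml
  _∨̇_  : Fml → Fml → Fml
  □̇    : Fml → Fml
  ◇̇    : Fml → Fml
  μ̇    : Var → Fml → Fml
  ν̇    : Var → Fml → Fml

NegFree : Var → Fml → Set
NegFree x (var y)   = ⊥
NegFree x (nvar y)  = x ≡ y
NegFree x (φ ∧̇ ψ)   = NegFree x φ ⊎ NegFree x ψ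
NegFree x (φ ∨̇ ψ)   = NegFree x φ ⊎ NegFree x ψ
NegFree x (□̇ φ)     = NegFree x φ
NegFree x (◇̇ φ)     = NegFree x φ
NegFree x (μ̇ y φ)   = x ≢ y × NegFree x φ
NegFree x (ν̇ y φ)   = x ≢ y × NegFree x φ

WF : Fml → Set
WF (var y)   = ⊤
WF (nvar y)  = ⊤
WF (φ ∧̇ ψ)   = WF φ × WF ψ
WF (φ ∨̇ ψ)   = WF φ × WF ψ
WF (□̇ φ)     = WF φ
WF (◇̇ φ)     = WF φ
WF (μ̇ x φ)   = WF φ × ¬ NegFree x φ
WF (ν̇ x φ)   = WF φ × ¬ NegFree x φ

Occurs : Var → Fml → Set
Occurs p (var y)   = p ≡ y
Occurs p (nvar y)  = p ≡ y
Occurs p (φ ∧̇ ψ)   = Occurs p φ ⊎ Occurs p ψ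
Occurs p (φ ∨̇ ψ)   = Occurs p φ ⊎ Occurs p ψ
Occurs p (□̇ φ)     = Occurs p φ
Occurs p (◇̇ φ)     = Occurs p φ
Occurs p (μ̇ y φ)   = p ≡ y ⊎ Occurs p φ
Occurs p (ν̇ y φ)   = p ≡ y ⊎ Occurs p φ

module Sem (lem : LEM) (F : Frame) where
  dec : Set → Bool
  dec P = ⌊ lem P ⌋

  ⟦_⟧ : Fml → Valuation F → Subset (St F)
  ⟦ var p ⟧  V t = V p t
  ⟦ nvar p ⟧ V t = not (V p t)
  ⟦ φ ∧̇ ψ ⟧  V t = ⟦ φ ⟧ V t and ⟦ ψ ⟧ V t
  ⟦ φ ∨̇ ψ ⟧  V t = ⟦ φ ⟧ V t or ⟦ ψ ⟧ V t
  ⟦ □̇ φ ⟧    V t = dec (σ F t (⟦ φ ⟧ V))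
  ⟦ ◇̇ φ ⟧    V t = not (dec (σ F t (λ u → not (⟦ φ ⟧ V u))))
  ⟦ μ̇ x φ ⟧  V t = dec ((X : Subset (St F)) →
                     (∀ u → T (⟦ φ ⟧ (_[_↦_] {F} V x X) u) → T (X u)) → T (X t))
  ⟦ ν̇ x φ ⟧  V t = dec (Σ (Subset (St F)) λ X →
                     (∀ u → T (X u) → T (⟦ φ ⟧ (_[_↦_] {F} V x X) u)) × T (X t))

data NF : Set where
  sr    : Var → NF
  _⊆̇_   : Var → Var → NF
  box   : Var → Var → NF
  ¬̇_    : NF → NF
  _∧ₙ_  : NF → NF → NF
  _∨ₙ_  : NF → NF → NF
  ∃̇     : Var → NF → NF

OccursN : Var → NF → Set
OccursN x (sr p)     = x ≡ p
OccursN x (p ⊆̇ q)    = x ≡ p ⊎ x ≡ q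
OccursN x (box p q)  = x ≡ p ⊎ x ≡ q
OccursN x (¬̇ ψ)      = OccursN x ψ
OccursN x (ψ ∧ₙ χ)   = OccursN x ψ ⊎ OccursN x χ
OccursN x (ψ ∨ₙ χ)   = OccursN x ψ ⊎ OccursN x χ
OccursN x (∃̇ p ψ)    = x ≡ p ⊎ OccursN x ψ

Sat : (F : Frame) → Valuation F → St F → NF → Set
Sat F V s (sr p)    = T (V p s) × (∀ t → T (V p t) → t ≡ s)
Sat F V s (p ⊆̇ q)   = ∀ t → T (V p t) → T (V q t)
Sat F V s (box p q) = ∀ t → T (V p t) → σ F t (V q)
Sat F V s (¬̇ ψ)     = ¬ Sat F V s ψ
Sat F V s (ψ ∧ₙ χ)  = Sat F V s ψ × Sat F V s χ
Sat F V s (ψ ∨ₙ χ)  = Sat F V s ψ ⊎ Sat F V s χ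
Sat F V s (∃̇ p ψ)   = Σ (Subset (St F)) λ X → Sat F (_[_↦_] {F} V p X) s ψ

cTrans : (Fml → Var → NF) → Fml → Var → Var → NF
cTrans Eq φ p q = ∃̇ p (∃̇ q (sr q ∧ₙ ((q ⊆̇ p) ∧ₙ Eq φ p)))

IsEqTranslation : LEM → (Fml → Var → NF) → Set₁
IsEqTranslation lem Eq =
  ∀ (φ : Fml) (p : Var) → WF φ →
  ∀ (F : Frame) (V : Valuation F) (s : St F) →
  Sat F V s (Eq φ p) ⇔ (∀ t → V p t ≡ Sem.⟦_⟧ lem F φ V t)

module Submission where

-- Eq(φ,p) forces the value of p to be the truth set ⟦φ⟧, and
-- sr(q) ∧ q ⊆ p says precisely that the current point s lies in the value
-- of p.  So c(φ) holds at s iff s ∈ ⟦φ⟧.  The only technical ingredient is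
-- the coincidence property of both languages: the truth of a formula only
-- depends on the values of the variables occurring in it.

open import Defs
open import Data.Bool using (T)
open import Relation.Nullary using (¬_)
open import Function.Bundles using (_⇔_)

open import Data.Bool using (true; false; not) renaming (_∧_ to _and_; _∨_ to _or_)
open import Data.Nat using (_≟_)
open import Data.Product using (_×_; _,_)
open import Data.Sum using (inj₁; inj₂)
open import Data.Empty using (⊥-elim)
open import Relation.Nullary using (Dec; yes; no)
open import Relation.Binary.PropositionalEquality
  using (_≡_; _≢_; refl; sym; trans; cong; cong₂; subst)
open import Function.Bundles using (mk⇔; Equivalence)

module Valuations {F : Frame} where

  -- The update V [ x ↦ X ] of Defs with the frame fixed, so that it can be
  -- written infix without annotating the frame.
  _[_≔_] : Valuation F → Var → Subset (St F) → Valuation F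
  V [ x ≔ X ] = _[_↦_] {F} V x X

  AgreeOn : (Var → Set) → Valuation F → Valuation F → Set
  AgreeOn P V W = ∀ y → P y → ∀ t → V y t ≡ W y t

  agree-sym : ∀ {P V W} → AgreeOn P V W → AgreeOn P W V
  agree-sym ag y Py t = sym (ag y Py t)

  agree-restrict : ∀ {P Q : Var → Set} {V W} → (∀ {y} → Q y → P y) →
                   AgreeOn P V W → AgreeOn Q V W
  agree-restrict Q⇒P ag y Qy = ag y (Q⇒P Qy)

  update-same : ∀ (V : Valuation F) x X t → (V [ x ≔ X ]) x t ≡ X t
  update-same V x X t with x ≟ x
  ... | yes _   = refl
  ... | no x≢x = ⊥-elim (x≢x refl)

  update-other : ∀ (V : Valuation F) x X {y} → y ≢ x → ∀ t → (V [ x ≔ X ]) y t ≡ V y t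
  update-other V x X {y} y≢x t with y ≟ x
  ... | yes y≡x = ⊥-elim (y≢x y≡x)
  ... | no _    = refl

  update-agree : ∀ {P V W} x X → AgreeOn P V W → AgreeOn P (V [ x ≔ X ]) (W [ x ≔ X ])
  update-agree x X ag y Py t with y ≟ x
  ... | yes _ = refl
  ... | no _  = ag y Py t

  update-fresh : ∀ {P : Var → Set} (V : Valuation F) x X → ¬ P x → AgreeOn P (V [ x ≔ X ]) V
  update-fresh {P} V x X ¬Px y Py = update-other V x X (λ y≡x → ¬Px (subst P y≡x Py))

  update-under : ∀ (V : Valuation F) {p q} X Y → p ≢ q → ∀ t →
                 ((V [ p ≔ X ]) [ q ≔ Y ]) p t ≡ X t
  update-under V {p} {q} X Y p≢q t =
    trans (update-other (V [ p ≔ X ]) q Y p≢q t) (update-same V p X t)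

module NMSOCoincidence (F : Frame) where
  open Valuations {F}

  σ-ext : ∀ {t} {X Y : Subset (St F)} → (∀ u → X u ≡ Y u) → σ F t X → σ F t Y
  σ-ext X≡Y = upward F (λ u → subst T (X≡Y u))

  satCoincide : ∀ ψ {V W} s → AgreeOn (λ y → OccursN y ψ) V W → Sat F V s ψ → Sat F W s ψ
  satCoincide (sr p) s ag (p∋s , p⊆s) =
    subst T (ag p refl s) p∋s , λ t p∋t → p⊆s t (subst T (sym (ag p refl t)) p∋t)
  satCoincide (p ⊆̇ q) s ag p⊆q t p∋t =
    subst T (ag q (inj₂ refl) t) (p⊆q t (subst T (sym (ag p (inj₁ refl) t)) p∋t))
  satCoincide (box p q) s ag hyp t p∋t =
    σ-ext (ag q (inj₂ refl)) (hyp t (subst T (sym (ag p (inj₁ refl) t)) p∋t))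
  satCoincide (¬̇ ψ) s ag ¬ψ ψ′ = ¬ψ (satCoincide ψ s (agree-sym ag) ψ′)
  satCoincide (ψ ∧ₙ χ) s ag (a , b) =
    satCoincide ψ s (agree-restrict inj₁ ag) a , satCoincide χ s (agree-restrict inj₂ ag) b
  satCoincide (ψ ∨ₙ χ) s ag (inj₁ a) = inj₁ (satCoincide ψ s (agree-restrict inj₁ ag) a)
  satCoincide (ψ ∨ₙ χ) s ag (inj₂ b) = inj₂ (satCoincide χ s (agree-restrict inj₂ ag) b)
  satCoincide (∃̇ p ψ) s ag (X , h) =
    X , satCoincide ψ s (agree-restrict inj₂ (update-agree p X ag)) h

  satFresh : ∀ ψ {q} (V : Valuation F) Y s → ¬ OccursN q ψ →
             Sat F (V [ q ≔ Y ]) s ψ ⇔ Sat F V s ψ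
  satFresh ψ V Y s q∉ψ = mk⇔
    (satCoincide ψ s (update-fresh V _ Y q∉ψ))
    (satCoincide ψ s (agree-sym (update-fresh V _ Y q∉ψ)))

module μCoincidence (lem : LEM) (F : Frame) where
  open Sem lem F
  open Valuations {F}
  open NMSOCoincidence F using (σ-ext)

  dec-cong : {P Q : Set} → (P → Q) → (Q → P) → dec P ≡ dec Q
  dec-cong {P} {Q} P⇒Q Q⇒P with lem P | lem Q
  ... | yes _  | yes _  = refl
  ... | no _   | no _   = refl
  ... | yes p  | no ¬q  = ⊥-elim (¬q (P⇒Q p))
  ... | no ¬p  | yes q  = ⊥-elim (¬p (Q⇒P q))

  σ-dec-cong : ∀ {t} {X Y : Subset (St F)} → (∀ u → X u ≡ Y u) → dec (σ F t X) ≡ dec (σ F t Y)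
  σ-dec-cong X≡Y = dec-cong (σ-ext X≡Y) (σ-ext (λ u → sym (X≡Y u)))

  semCoincide : ∀ φ {V W} → AgreeOn (λ y → Occurs y φ) V W → ∀ t → ⟦ φ ⟧ V t ≡ ⟦ φ ⟧ W t
  semCoincide (var p) ag t = ag p refl t
  semCoincide (nvar p) ag t = cong not (ag p refl t)
  semCoincide (φ ∧̇ ψ) ag t =
    cong₂ _and_ (semCoincide φ (agree-restrict inj₁ ag) t) (semCoincide ψ (agree-restrict inj₂ ag) t)
  semCoincide (φ ∨̇ ψ) ag t =
    cong₂ _or_ (semCoincide φ (agree-restrict inj₁ ag) t) (semCoincide ψ (agree-restrict inj₂ ag) t)
  semCoincide (□̇ φ) ag t = σ-dec-cong (semCoincide φ ag)
  semCoincide (◇̇ φ) ag t = cong not (σ-dec-cong (λ u → cong not (semCoincide φ ag u)))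
  semCoincide (μ̇ x φ) ag t = dec-cong
      (λ least X pre → least X (λ u φu → pre u (subst T (body X u) φu)))
      (λ least X pre → least X (λ u φu → pre u (subst T (sym (body X u)) φu)))
    where body = λ X → semCoincide φ (agree-restrict inj₂ (update-agree x X ag))
  semCoincide (ν̇ x φ) ag t = dec-cong
      (λ { (X , post , Xt) → X , (λ u Xu → subst T (body X u) (post u Xu)) , Xt })
      (λ { (X , post , Xt) → X , (λ u Xu → subst T (sym (body X u)) (post u Xu)) , Xt })
    where body = λ X → semCoincide φ (agree-restrict inj₂ (update-agree x X ag))

  semFresh : ∀ φ {p} (V : Valuation F) X → ¬ Occurs p φ → ∀ t → ⟦ φ ⟧ (V [ p ≔ X ]) t ≡ ⟦ φ ⟧ V t
  semFresh φ V X p∉φ = semCoincide φ (update-fresh V _ X p∉φ)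

module EqTranslation (lem : LEM) (Eq : Fml → Var → NF) (isEq : IsEqTranslation lem Eq)
                     (F : Frame) where
  open Sem lem F
  open Valuations {F}
  open NMSOCoincidence F
  open μCoincidence lem F

  eq-update : ∀ φ p → WF φ → ¬ Occurs p φ → ∀ V X s →
              Sat F (V [ p ≔ X ]) s (Eq φ p) ⇔ (∀ t → X t ≡ ⟦ φ ⟧ V t)
  eq-update φ p wf p∉φ V X s = mk⇔
    (λ sat t → trans (sym (update-same V p X t))
                     (trans (Equivalence.to spec sat t) (semFresh φ V X p∉φ t)))
    (λ X≡φ → Equivalence.from spec (λ t →
       trans (update-same V p X t) (trans (X≡φ t) (sym (semFresh φ V X p∉φ t)))))
    where spec = isEq φ p wf F (V [ p ≔ X ]) s

  eq-update₂ : ∀ φ p {q} → WF φ → ¬ Occurs p φ → ¬ OccursN q (Eq φ p) → ∀ V X Y s →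
               Sat F ((V [ p ≔ X ]) [ q ≔ Y ]) s (Eq φ p) ⇔ (∀ t → X t ≡ ⟦ φ ⟧ V t)
  eq-update₂ φ p wf p∉φ q∉Eq V X Y s = mk⇔
    (λ sat → Equivalence.to (eq-update φ p wf p∉φ V X s)
               (Equivalence.to (satFresh (Eq φ p) (V [ p ≔ X ]) Y s q∉Eq) sat))
    (λ X≡φ → Equivalence.from (satFresh (Eq φ p) (V [ p ≔ X ]) Y s q∉Eq)
               (Equivalence.from (eq-update φ p wf p∉φ V X s) X≡φ))

  -- Eq(φ,p) must mention p, since it pins down the value of p: otherwise
  -- both ⟦φ⟧ and its complement would be admissible values for p.
  eq-mentions : ∀ φ p → WF φ → ¬ Occurs p φ → Valuation F → St F → ¬ ¬ OccursN p (Eq φ p)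
  eq-mentions φ p wf p∉φ V s p∉Eq = not-fixed (⟦ φ ⟧ V s) (Equivalence.to (eq-update φ p wf p∉φ V co s) satCo s)
    where
    co : Subset (St F)
    co t = not (⟦ φ ⟧ V t)
    satCo : Sat F (V [ p ≔ co ]) s (Eq φ p)
    satCo = Equivalence.from (satFresh (Eq φ p) V co s p∉Eq)
              (Equivalence.to (satFresh (Eq φ p) V (⟦ φ ⟧ V) s p∉Eq)
                (Equivalence.from (eq-update φ p wf p∉φ V (⟦ φ ⟧ V) s) (λ _ → refl)))
    not-fixed : ∀ b → not b ≢ b
    not-fixed true  ()
    not-fixed false ()

module Singletons (lem : LEM) (F : Frame) where
  open Sem lem F using (dec)
  open Valuations {F}

  singleton : St F → Subset (St F)
  singleton s t = dec (t ≡ s)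

  singleton-self : ∀ s → T (singleton s s)
  singleton-self s with lem (s ≡ s)
  ... | yes _   = _
  ... | no s≢s = s≢s refl

  singleton-only : ∀ {s t} → T (singleton s t) → t ≡ s
  singleton-only {s} {t} t∈s with lem (t ≡ s)
  ... | yes t≡s = t≡s
  ... | no _    = ⊥-elim t∈s

  singleton-witness : ∀ (V : Valuation F) {p q} X s → p ≢ q → T (X s) →
                      let W = (V [ p ≔ X ]) [ q ≔ singleton s ] in
                      Sat F W s (sr q) × Sat F W s (q ⊆̇ p)
  singleton-witness V {p} {q} X s p≢q s∈X = isSr , q⊆p
    where
    W = (V [ p ≔ X ]) [ q ≔ singleton s ]
    in-q : ∀ {t} → T (W q t) → t ≡ s
    in-q {t} q∋t = singleton-only (subst T (update-same (V [ p ≔ X ]) q (singleton s) t) q∋t)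
    isSr : Sat F W s (sr q)
    isSr = subst T (sym (update-same (V [ p ≔ X ]) q (singleton s) s)) (singleton-self s)
         , λ t q∋t → in-q q∋t
    q⊆p : Sat F W s (q ⊆̇ p)
    q⊆p t q∋t = subst T (sym (update-under V X (singleton s) p≢q t))
                  (subst (λ u → T (X u)) (sym (in-q q∋t)) s∈X)

  point-in : ∀ (V : Valuation F) {p q} X Y s → p ≢ q →
             let W = (V [ p ≔ X ]) [ q ≔ Y ] in
             Sat F W s (sr q) → Sat F W s (q ⊆̇ p) → T (X s)
  point-in V X Y s p≢q (q∋s , _) q⊆p =
    subst T (update-under V X Y p≢q s) (q⊆p s q∋s)

cTrans-correct : (lem : LEM) (Eq : Fml → Var → NF) → IsEqTranslation lem Eq →
    ∀ (φ : Fml) (p q : Var) → WF φ → ¬ Occurs p φ → ¬ OccursN q (Eq φ p) → p ≢ q →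
    ∀ (F : Frame) (V : Valuation F) (s : St F) →
    T (Sem.⟦_⟧ lem F φ V s) ⇔ Sat F V s (cTrans Eq φ p q)
cTrans-correct lem Eq isEq φ p q wf p∉φ q∉Eq p≢q F V s = mk⇔ forward backward
  where
  open Sem lem F
  open EqTranslation lem Eq isEq F
  open Singletons lem F

  forward : T (⟦ φ ⟧ V s) → Sat F V s (cTrans Eq φ p q)
  forward s∈φ with singleton-witness V (⟦ φ ⟧ V) s p≢q s∈φ
  ... | isSr , q⊆p = ⟦ φ ⟧ V , singleton s , isSr , q⊆p ,
        Equivalence.from (eq-update₂ φ p wf p∉φ q∉Eq V (⟦ φ ⟧ V) (singleton s) s) (λ _ → refl)

  backward : Sat F V s (cTrans Eq φ p q) → T (⟦ φ ⟧ V s)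
  backward (X , Y , isSr , q⊆p , eq) =
    subst T (Equivalence.to (eq-update₂ φ p wf p∉φ q∉Eq V X Y s) eq s)
            (point-in V X Y s p≢q isSr q⊆p)

-- The case p = q cannot arise: Eq(φ,p) must mention p, yet q is fresh in it.
mainTheorem2 : (lem : LEM) (Eq : Fml → Var → NF) → IsEqTranslation lem Eq →
    ∀ (φ : Fml) (p q : Var) → WF φ → ¬ Occurs p φ → ¬ OccursN q (Eq φ p) →
    ∀ (F : Frame) (V : Valuation F) (s : St F) →
    T (Sem.⟦_⟧ lem F φ V s) ⇔ Sat F V s (cTrans Eq φ p q)
mainTheorem2 lem Eq isEq φ p q wf p∉φ q∉Eq F V s = byCases (p ≟ q)
  where
  byCases : Dec (p ≡ q) → T (Sem.⟦_⟧ lem F φ V s) ⇔ Sat F V s (cTrans Eq φ p q)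
  byCases (yes refl) = ⊥-elim (EqTranslation.eq-mentions lem Eq isEq F φ p wf p∉φ V s q∉Eq)
  byCases (no p≢q)   = cTrans-correct lem Eq isEq φ p q wf p∉φ q∉Eq p≢q F V s
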